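{- Let $G$ be a unicyclic graph on $n$ vertices whose unique cycle $C$ has length $g$. Let $n_1,\dots,n_g$ be the numbers of vertices of the $g$ connected components of the graph obtained from $G$ by deleting all edges of $C$. Then \[ \mathrm{pn}(G)=n+2\binom{n}{2}-\binom{n_1}{2}-\binom{n_2}{2}-\dots-\binom{n_g}{2}. \]
   Context: All graphs are finite and simple. A unicyclic graph is a connected graph containing exactly one cycle. For a graph $G$, the subpath number $\mathrm{pn}(G)$ is the number of paths (as subgraphs, i.e. unordered) in $G$, including the trivial paths of length $0$ (single vertices). -}

module Defs where

open import Data.Bool using (Bool; true; false; not; _∧_; _∨_; T)
open import Data.Fin using (Fin; toℕ)
open import Data.Fin.Properties using (_≟_)
open import Data.List using (List; []; _∷_; [_]; _++_; length; filterᵇ; allFin)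
open import Data.Bool.ListAction using (any)
open import Data.Nat using (ℕ; zero; suc; _<ᵇ_; _≤ᵇ_)
open import Data.Product using (Σ)
open import Relation.Binary.PropositionalEquality using (_≡_)
open import Relation.Nullary.Decidable using (⌊_⌋)

record Graph (n : ℕ) : Set where
  field
    adj        : Fin n → Fin n → Bool
    adj-sym    : ∀ u v → adj u v ≡ adj v u
    adj-irrefl : ∀ u → adj u u ≡ false
open Graph public

module _ {n : ℕ} where

  eqB : Fin n → Fin n → Bool
  eqB u v = ⌊ u ≟ v ⌋

  distinct : List (Fin n) → Bool
  distinct []       = true
  distinct (x ∷ xs) = not (any (eqB x) xs) ∧ distinct xs

  chain : (Fin n → Fin n → Bool) → List (Fin n) → Bool
  chain a []           = true
  chain a (x ∷ [])     = true
  chain a (x ∷ y ∷ xs) = a x y ∧ chain a (y ∷ xs)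

  lastOf : Fin n → List (Fin n) → Fin n
  lastOf x []       = x
  lastOf x (y ∷ ys) = lastOf y ys

  -- canonical orientation of a vertex sequence of a path:
  -- a single vertex, or first vertex has smaller index than last vertex.
  -- (A path subgraph with >= 1 edge has exactly two traversals, reverses of
  --  each other; exactly one of them is canonical.)
  canonical : List (Fin n) → Bool
  canonical []           = false
  canonical (x ∷ [])     = true
  canonical (x ∷ y ∷ xs) = toℕ x <ᵇ toℕ (lastOf y xs)

  closeup : List (Fin n) → List (Fin n)
  closeup []       = []
  closeup (x ∷ xs) = x ∷ xs ++ [ x ]

  edgeIn : List (Fin n) → Fin n → Fin n → Bool
  edgeIn []           u v = false
  edgeIn (x ∷ [])     u v = false
  edgeIn (x ∷ y ∷ xs) u v = (eqB x u ∧ eqB y v) ∨ (eqB x v ∧ eqB y u) ∨ edgeIn (y ∷ xs) u v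

  cycEdge : List (Fin n) → Fin n → Fin n → Bool
  cycEdge cs = edgeIn (closeup cs)

  reachIn : (Fin n → Fin n → Bool) → ℕ → Fin n → Fin n → Bool
  reachIn a zero    u v = eqB u v
  reachIn a (suc k) u v = reachIn a k u v ∨ any (λ w → reachIn a k u w ∧ a w v) (allFin n)

isPathSeq : ∀ {n} → Graph n → List (Fin n) → Bool
isPathSeq G vs = distinct vs ∧ chain (adj G) vs ∧ canonical vs

-- the paths of G as subgraphs (including trivial ones), one representative each
PathSubgraph : ∀ {n} → Graph n → Set
PathSubgraph G = Σ (List _) (λ vs → T (isPathSeq G vs))

isCycle : ∀ {n} → Graph n → List (Fin n) → Bool
isCycle G cs = (3 ≤ᵇ length cs) ∧ distinct cs ∧ chain (adj G) (closeup cs)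

Connected : ∀ {n} → Graph n → Set
Connected {n} G = ∀ u v → T (reachIn (adj G) n u v)

delEdges : ∀ {n} → Graph n → List (Fin n) → Fin n → Fin n → Bool
delEdges G cs u v = adj G u v ∧ not (cycEdge cs u v)

compSize : ∀ {n} → Graph n → List (Fin n) → Fin n → ℕ
compSize {n} G cs c = length (filterᵇ (reachIn (delEdges G cs) n c) (allFin n))

-- Grow a vertex set S from the cycle C one vertex at a time.  Connectivity gives an edge w ℓ
-- with w ∈ S and ℓ ∉ S, and w is the only neighbour of ℓ in S, since a second one would close a
-- cycle through ℓ ∉ C.  So every vertex hangs off a root on C in the forest G − E(C), and by
-- induction two vertices are joined by exactly one path if they have the same root and by exactly
-- two otherwise (on C itself these are the two arcs).  Counting the n trivial paths and, for each
-- pair u < v, its one or two paths gives n + 2·C(n,2) − Σᵢ C(nᵢ,2), where C(nᵢ,2) counts the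
-- pairs rooted at the i-th cycle vertex.

module Submission where

open import Defs
open import Data.Bool using (Bool; T; _∧_; _∨_; false; if_then_else_; not; true)
open import Data.Bool.Properties using (T-irrelevant; ∨-assoc; ∨-comm; ∨-identityʳ; ∨-zeroʳ)
open import Data.Bool.ListAction using (any)
open import Data.Empty using (⊥; ⊥-elim)
open import Data.Fin using (Fin; suc; toℕ; zero; punchIn)
open import Data.Fin.Properties using (_≟_; +↔⊎; any?; punchInᵢ≢i)
open import Data.List using (List; []; [_]; _++_; _∷_; allFin; filterᵇ; length; map; tabulate)
open import Data.List.Properties using (++-assoc; ++-identityʳ; length-++-comm)
open import Data.Nat using (ℕ; _*_; _+_; _<ᵇ_; _∸_; _≤_; _≤ᵇ_; suc; zero; z≤n; s≤s)
open import Data.Nat.Combinatorics using (_C_; nC1≡n; nCk+nC[k+1]≡[n+1]C[k+1])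
open import Data.Nat.ListAction using (sum)
open import Data.Nat.Properties using (<ᵇ⇒<; <-irrefl; +-0-commutativeMonoid; +-assoc; +-identityʳ; +-suc; m+n∸n≡m; m∸n+n≡m; n≤1+n; ≤-trans; suc-injective; m+n≡0⇒m≡0; m+n≡0⇒n≡0; 1+n≢0)
open import Algebra.Properties.CommutativeMonoid.Sum +-0-commutativeMonoid
  using (sum-syntax; ∑-distrib-+; sum-cong-≗; sum-remove; sum-replicate-zero) renaming (sum to ∑)
open import Data.Product using (_,_; _×_; proj₁; proj₂; Σ; Σ-syntax)
open import Data.Product.Function.Dependent.Propositional using (congˡ)
open import Data.Sum using (_⊎_; inj₁; inj₂; [_,_]′)
open import Data.Sum.Function.Propositional using (_⊎-↔_)
open import Data.List.Membership.Propositional using (lose)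
open import Data.List.Membership.Propositional.Properties using (∈-allFin)
open import Data.List.Relation.Unary.Any using (satisfied)
open import Data.List.Relation.Unary.Any.Properties using (any⁺; any⁻)
open import Data.Unit using (tt)
open import Function using (_∘_)
open import Function.Bundles using (_↔_; mk↔ₛ′; Inverse)
open import Function.Properties.Inverse using (↔-refl; ↔-sym; ↔-trans)
open import Function.Related.Propositional using (bijection)
open import Relation.Binary.PropositionalEquality hiding ([_])
open import Relation.Nullary using (yes; no; ¬_)
open import Relation.Nullary.Decidable using (T?; toWitness; fromWitness)
open import Axiom.UniquenessOfIdentityProofs using (module Decidable⇒UIP)
open import Relation.Binary.Definitions using (DecidableEquality)

∧-intro : ∀ {a b} → T a → T b → T (a ∧ b)
∧-intro {true} {true} _ _ = tt

∧-elimˡ : ∀ {a b} → T (a ∧ b) → T a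
∧-elimˡ {true} _ = tt

∧-elimʳ : ∀ {a b} → T (a ∧ b) → T b
∧-elimʳ {true} p = p

∨-introˡ : ∀ {a b} → T a → T (a ∨ b)
∨-introˡ {true} _ = tt

∨-introʳ : ∀ {a b} → T b → T (a ∨ b)
∨-introʳ {true} _ = tt
∨-introʳ {false} p = p

∨-elim : ∀ {a b} → T (a ∨ b) → T a ⊎ T b
∨-elim {true} _ = inj₁ tt
∨-elim {false} p = inj₂ p

not-intro : ∀ {b} → ¬ T b → T (not b)
not-intro {true} f = f tt
not-intro {false} _ = tt

not-elim : ∀ {b} → T (not b) → ¬ T b
not-elim {true} ()

T⇒≡true : ∀ {b} → T b → b ≡ true
T⇒≡true {true} _ = refl

¬T⇒≡false : ∀ {b} → ¬ T b → b ≡ false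
¬T⇒≡false {true} f = ⊥-elim (f tt)
¬T⇒≡false {false} _ = refl

¬T-not⇒T : ∀ {b} → ¬ T (not b) → T b
¬T-not⇒T {true} _ = tt
¬T-not⇒T {false} f = ⊥-elim (f tt)

module _ {n : ℕ} where

  eqB⇒≡ : {u v : Fin n} → T (eqB u v) → u ≡ v
  eqB⇒≡ {u} {v} = toWitness {a? = u ≟ v}

  ≡⇒eqB : {u v : Fin n} → u ≡ v → T (eqB u v)
  ≡⇒eqB {u} {v} = fromWitness {a? = u ≟ v}

  eqB-refl : (u : Fin n) → T (eqB u u)
  eqB-refl u = ≡⇒eqB refl

  ≢⇒eqB≡false : {u v : Fin n} → ¬ u ≡ v → eqB u v ≡ false
  ≢⇒eqB≡false {u} {v} f with u ≟ v
  ... | yes e = ⊥-elim (f e)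
  ... | no _ = refl

  eqB-sym : (u v : Fin n) → eqB u v ≡ eqB v u
  eqB-sym u v with u ≟ v | v ≟ u
  ... | yes _ | yes _ = refl
  ... | no _ | no _ = refl
  ... | yes e | no f = ⊥-elim (f (sym e))
  ... | no f | yes e = ⊥-elim (f (sym e))


-- Counting

χ : Bool → ℕ
χ b = if b then 1 else 0

count : ∀ {m} → (Fin m → Bool) → ℕ
count {m} P = ∑[ i < m ] χ (P i)

count-true : ∀ m → count {m} (λ _ → true) ≡ m
count-true zero = refl
count-true (suc m) = cong suc (count-true m)

_<ᶠ_ : ∀ {m} → Fin m → Fin m → Bool
u <ᶠ v = toℕ u <ᵇ toℕ v

∑-pairs≡C2 : ∀ {m} (P : Fin m → Bool) → ∑[ u < m ] ∑[ v < m ] χ (u <ᶠ v ∧ (P u ∧ P v)) ≡ count P C 2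
∑-pairs≡C2 {zero} P = refl
∑-pairs≡C2 {suc m} P = begin
    ∑[ v < m ] χ (P zero ∧ P (suc v)) + ∑[ u < m ] ∑[ v < m ] χ (u <ᶠ v ∧ (P (suc u) ∧ P (suc v)))
  ≡⟨ cong₂ _+_ (firstRow (P zero)) (∑-pairs≡C2 (λ i → P (suc i))) ⟩
    (if P zero then c else 0) + c C 2
  ≡⟨ C2-step (P zero) ⟩
    count P C 2 ∎
  where
    open ≡-Reasoning
    c : ℕ
    c = count (λ i → P (suc i))
    firstRow : ∀ b → ∑[ v < m ] χ (b ∧ P (suc v)) ≡ (if b then c else 0)
    firstRow true = refl
    firstRow false = sum-replicate-zero m
    C2-step : ∀ b → (if b then c else 0) + c C 2 ≡ (χ b + c) C 2
    C2-step true = trans (cong (_+ c C 2) (sym (nC1≡n c))) (nCk+nC[k+1]≡[n+1]C[k+1] c 1)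
    C2-step false = refl

∑∑-distrib-+ : ∀ {m} (f g : Fin m → Fin m → ℕ) →
               ∑[ u < m ] ∑[ v < m ] (f u v + g u v) ≡ ∑[ u < m ] ∑[ v < m ] f u v + ∑[ u < m ] ∑[ v < m ] g u v
∑∑-distrib-+ {m} f g =
  trans (sum-cong-≗ (λ u → ∑-distrib-+ (f u) (g u))) (∑-distrib-+ (λ u → ∑[ v < m ] f u v) (λ u → ∑[ v < m ] g u v))

∑-sum-comm : ∀ {m} {A : Set} (f : Fin m → A → ℕ) (L : List A) →
             ∑[ i < m ] sum (map (f i) L) ≡ sum (map (λ c → ∑[ i < m ] f i c) L)
∑-sum-comm {m} f [] = sum-replicate-zero m
∑-sum-comm f (c ∷ L) = trans (∑-distrib-+ (λ i → f i c) (λ i → sum (map (f i) L)))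
                              (cong (∑ (λ i → f i c) +_) (∑-sum-comm f L))

count-cong : ∀ {m} {P Q : Fin m → Bool} → (∀ z → P z ≡ Q z) → count P ≡ count Q
count-cong e = sum-cong-≗ (λ z → cong χ (e z))

count≡0⇒¬T : ∀ {m} (P : Fin m → Bool) → count P ≡ 0 → ∀ z → ¬ T (P z)
count≡0⇒¬T P e zero = χ≡0⇒¬T (m+n≡0⇒m≡0 (χ (P zero)) e)
  where
    χ≡0⇒¬T : ∀ {b} → χ b ≡ 0 → ¬ T b
    χ≡0⇒¬T {true} ()
count≡0⇒¬T P e (suc z) = count≡0⇒¬T (P ∘ suc) (m+n≡0⇒n≡0 (χ (P zero)) e) z

count-witness : ∀ {m k} (P : Fin m → Bool) → count P ≡ suc k → Σ[ z ∈ Fin m ] T (P z)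
count-witness {m} P e with any? (λ z → T? (P z))
... | yes w = w
... | no none = ⊥-elim (1+n≢0 (trans (sym e) (trans (count-cong (λ z → ¬T⇒≡false (λ p → none (z , p))))
                                                    (sum-replicate-zero m))))

count-remove : ∀ {m} {P Q : Fin m → Bool} ℓ → T (P ℓ) → ¬ T (Q ℓ) → (∀ z → ¬ z ≡ ℓ → P z ≡ Q z) →
               count P ≡ suc (count Q)
count-remove {suc m} {P} {Q} ℓ Pℓ ¬Qℓ same = begin
    count P
  ≡⟨ sum-remove {i = ℓ} (χ ∘ P) ⟩
    χ (P ℓ) + ∑[ j < m ] χ (P (punchIn ℓ j))
  ≡⟨ cong₂ _+_ (cong χ (T⇒≡true Pℓ)) (sum-cong-≗ (λ j → cong χ (same (punchIn ℓ j) (punchInᵢ≢i ℓ j)))) ⟩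
    suc (∑[ j < m ] χ (Q (punchIn ℓ j)))
  ≡⟨ cong (λ b → suc (χ b + ∑[ j < m ] χ (Q (punchIn ℓ j)))) (sym (¬T⇒≡false ¬Qℓ)) ⟩
    suc (χ (Q ℓ) + ∑[ j < m ] χ (Q (punchIn ℓ j)))
  ≡⟨ cong suc (sym (sum-remove {i = ℓ} (χ ∘ Q))) ⟩
    suc (count Q) ∎
  where open ≡-Reasoning

count≤ : ∀ {m} (P : Fin m → Bool) → count P ≤ m
count≤ {zero} P = z≤n
count≤ {suc m} P with P zero
... | true = s≤s (count≤ (P ∘ suc))
... | false = ≤-trans (count≤ (P ∘ suc)) (n≤1+n m)

Σ-Fin↔Fin-∑ : ∀ {m} (f : Fin m → ℕ) → Σ (Fin m) (λ i → Fin (f i)) ↔ Fin (∑[ i < m ] f i)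
Σ-Fin↔Fin-∑ {zero} f = mk↔ₛ′ (λ ()) (λ ()) (λ ()) (λ ())
Σ-Fin↔Fin-∑ {suc m} f =
  ↔-trans splitFirst (↔-trans (↔-refl ⊎-↔ Σ-Fin↔Fin-∑ (λ i → f (suc i))) (↔-sym +↔⊎))
  where
    splitFirst : Σ (Fin (suc m)) (λ i → Fin (f i)) ↔ (Fin (f zero) ⊎ Σ (Fin m) (λ i → Fin (f (suc i))))
    splitFirst = mk↔ₛ′ (λ { (zero , a) → inj₁ a ; (suc i , a) → inj₂ (i , a) })
                       (λ { (inj₁ a) → zero , a ; (inj₂ (i , a)) → suc i , a })
                       (λ { (inj₁ a) → refl ; (inj₂ (i , a)) → refl })
                       (λ { (zero , a) → refl ; (suc i , a) → refl })

Σ-congˡ : ∀ {I : Set} {A B : I → Set} → (∀ {i} → A i ↔ B i) → Σ I A ↔ Σ I B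
Σ-congˡ = congˡ {k = bijection}

Fin-cast : ∀ {A : Set} {m k} → m ≡ k → A ↔ Fin m → A ↔ Fin k
Fin-cast refl e = e

T×↔Fin : ∀ b {A : Set} {k} → (T b → A ↔ Fin k) → (T b × A) ↔ Fin (if b then k else 0)
T×↔Fin true e = ↔-trans (mk↔ₛ′ proj₂ (tt ,_) (λ _ → refl) (λ _ → refl)) (e tt)
T×↔Fin false e = mk↔ₛ′ (λ ()) (λ ()) (λ ()) (λ ())

module _ {A : Set} (_≟ᴬ_ : DecidableEquality A) where

  open Decidable⇒UIP _≟ᴬ_ using (≡-irrelevant)

  Σ-unique↔ : ∀ {Q : A → Set} (P : A → Set) w → Q w → (∀ z → Q z → z ≡ w) →
              (∀ z (q q′ : Q z) → q ≡ q′) → Σ A (λ z → Q z × P z) ↔ P w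
  Σ-unique↔ {Q} P w qw unique Q-irr = mk↔ₛ′ to (λ p → w , qw , p) toFrom fromTo
    where
      to : Σ A (λ z → Q z × P z) → P w
      to (z , q , p) = subst P (unique z q) p
      toFrom : ∀ p → to (w , qw , p) ≡ p
      toFrom p rewrite ≡-irrelevant (unique w qw) refl = refl
      fromTo : ∀ x → (w , qw , to x) ≡ x
      fromTo (z , q , p) with unique z q
      ... | refl = cong (λ u → w , u , p) (Q-irr w qw q)

  Σ-two↔ : ∀ {Q : A → Set} (P : A → Set) w₁ w₂ → ¬ w₁ ≡ w₂ → Q w₁ → Q w₂ →
           (∀ z → Q z → z ≡ w₁ ⊎ z ≡ w₂) → (∀ z (q q′ : Q z) → q ≡ q′) →
           Σ A (λ z → Q z × P z) ↔ (P w₁ ⊎ P w₂)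
  Σ-two↔ {Q} P w₁ w₂ w₁≢w₂ q₁ q₂ cases Q-irr = mk↔ₛ′ to from toFrom fromTo
    where
      to : Σ A (λ z → Q z × P z) → P w₁ ⊎ P w₂
      to (z , q , p) with z ≟ᴬ w₁
      ... | yes e = inj₁ (subst P e p)
      ... | no z≢w₁ with cases z q
      ...   | inj₁ e = ⊥-elim (z≢w₁ e)
      ...   | inj₂ e = inj₂ (subst P e p)
      from : P w₁ ⊎ P w₂ → Σ A (λ z → Q z × P z)
      from (inj₁ p) = w₁ , q₁ , p
      from (inj₂ p) = w₂ , q₂ , p
      toFrom : ∀ x → to (from x) ≡ x
      toFrom (inj₁ p) with w₁ ≟ᴬ w₁
      ... | yes e rewrite ≡-irrelevant e refl = refl
      ... | no f = ⊥-elim (f refl)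
      toFrom (inj₂ p) with w₂ ≟ᴬ w₁
      ... | yes e = ⊥-elim (w₁≢w₂ (sym e))
      ... | no f with cases w₂ q₂
      ...   | inj₁ e = ⊥-elim (f e)
      ...   | inj₂ e rewrite ≡-irrelevant e refl = refl
      fromTo : ∀ x → from (to x) ≡ x
      fromTo (z , q , p) with z ≟ᴬ w₁
      ... | yes refl = cong (λ u → w₁ , u , p) (Q-irr w₁ q₁ q)
      ... | no f with cases z q
      ...   | inj₁ e = ⊥-elim (f e)
      ...   | inj₂ refl = cong (λ u → w₂ , u , p) (Q-irr w₂ q₂ q)

-- Paths inside a vertex set

module _ {n : ℕ} where

  Adj : Set
  Adj = Fin n → Fin n → Bool

  VSet : Set
  VSet = Fin n → Bool

  Symmetric : Adj → Set
  Symmetric a = ∀ u v → a u v ≡ a v u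

  mem : Fin n → List (Fin n) → Bool
  mem z = any (eqB z)

  allB : VSet → List (Fin n) → Bool
  allB S [] = true
  allB S (x ∷ xs) = S x ∧ allB S xs

  insert : Fin n → VSet → VSet
  insert ℓ S z = eqB z ℓ ∨ S z

  mem-here : ∀ z xs → T (mem z (z ∷ xs))
  mem-here z xs = ∨-introˡ (eqB-refl z)

  mem-there : ∀ {z} y xs → T (mem z xs) → T (mem z (y ∷ xs))
  mem-there {z} y xs = ∨-introʳ {eqB z y}

  mem-≡ : ∀ {z y} xs → z ≡ y → T (mem z (y ∷ xs))
  mem-≡ {z} xs refl = mem-here z xs

  mem-cases : ∀ {z y} xs → T (mem z (y ∷ xs)) → z ≡ y ⊎ T (mem z xs)
  mem-cases {z} {y} xs p with ∨-elim {eqB z y} p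
  ... | inj₁ q = inj₁ (eqB⇒≡ q)
  ... | inj₂ q = inj₂ q

  mem-++ : ∀ u L M → mem u (L ++ M) ≡ mem u L ∨ mem u M
  mem-++ u [] M = refl
  mem-++ u (y ∷ L) M = trans (cong (eqB u y ∨_) (mem-++ u L M)) (sym (∨-assoc (eqB u y) (mem u L) (mem u M)))

  mem-++-comm : ∀ u L M → mem u (L ++ M) ≡ mem u (M ++ L)
  mem-++-comm u L M = trans (mem-++ u L M) (trans (∨-comm (mem u L) (mem u M)) (sym (mem-++ u M L)))

  mem-singleton : ∀ {u x : Fin n} → T (mem u [ x ]) → u ≡ x
  mem-singleton {u} {x} p with ∨-elim {eqB u x} p
  ... | inj₁ e = eqB⇒≡ e

  split : ∀ z L → T (mem z L) → Σ[ A ∈ List (Fin n) ] Σ[ B ∈ List (Fin n) ] L ≡ A ++ z ∷ B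
  split z (y ∷ L) m with mem-cases L m
  ... | inj₁ e = [] , L , cong (_∷ L) (sym e)
  ... | inj₂ m' with split z L m'
  ...   | A , B , e = y ∷ A , B , cong (y ∷_) e

  last-mem : ∀ x rest → T (mem (lastOf x rest) (x ∷ rest))
  last-mem x [] = mem-here x []
  last-mem x (y ∷ rest) = mem-there x (y ∷ rest) (last-mem y rest)

  lastOf-snoc : ∀ (y : Fin n) L x → lastOf y (L ++ [ x ]) ≡ x
  lastOf-snoc y [] x = refl
  lastOf-snoc y (z ∷ L) x = lastOf-snoc z L x

  allB-mem : ∀ {S z} xs → T (allB S xs) → T (mem z xs) → T (S z)
  allB-mem (y ∷ xs) p q with mem-cases xs q
  ... | inj₁ refl = ∧-elimˡ p
  ... | inj₂ r = allB-mem xs (∧-elimʳ p) r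

  allB-intro : ∀ {S} xs → (∀ z → T (mem z xs) → T (S z)) → T (allB S xs)
  allB-intro [] f = tt
  allB-intro (x ∷ xs) f = ∧-intro (f x (mem-here x xs)) (allB-intro xs (λ z m → f z (mem-there x xs m)))

  allB-mono : ∀ {S S'} xs → (∀ z → T (S z) → T (S' z)) → T (allB S xs) → T (allB S' xs)
  allB-mono xs f p = allB-intro xs (λ z m → f z (allB-mem xs p m))

  allB-true : ∀ xs → T (allB (λ _ → true) xs)
  allB-true [] = tt
  allB-true (x ∷ xs) = allB-true xs

  distinct-head : ∀ x xs → T (distinct (x ∷ xs)) → ¬ T (mem x xs)
  distinct-head x xs p = not-elim (∧-elimˡ {not (mem x xs)} p)

  distinct-tail : ∀ x xs → T (distinct (x ∷ xs)) → T (distinct xs)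
  distinct-tail x xs = ∧-elimʳ {not (mem x xs)}

  distinct-cons : ∀ x xs → ¬ T (mem x xs) → T (distinct xs) → T (distinct (x ∷ xs))
  distinct-cons x xs f = ∧-intro (not-intro f)

  chain-head : ∀ {a : Adj} x y xs → T (chain a (x ∷ y ∷ xs)) → T (a x y)
  chain-head x y xs = ∧-elimˡ

  chain-tail : ∀ {a : Adj} x xs → T (chain a (x ∷ xs)) → T (chain a xs)
  chain-tail x [] p = tt
  chain-tail {a} x (y ∷ xs) p = ∧-elimʳ {a x y} p

  chain-snoc : ∀ (a : Adj) y L x → T (chain a (y ∷ L)) → T (a (lastOf y L) x) → T (chain a (y ∷ L ++ [ x ]))
  chain-snoc a y [] x c e = ∧-intro e tt
  chain-snoc a y (z ∷ L) x c e = ∧-intro (chain-head y z L c) (chain-snoc a z L x (chain-tail y (z ∷ L) c) e)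

  chain-mono : ∀ {a b : Adj} L → (∀ u v → T (a u v) → T (b u v)) → T (chain a L) → T (chain b L)
  chain-mono [] f c = tt
  chain-mono (x ∷ []) f c = tt
  chain-mono (x ∷ y ∷ L) f c = ∧-intro (f x y (∧-elimˡ c)) (chain-mono (y ∷ L) f (∧-elimʳ c))

  -- x ∷ rest is a path of a from x to y inside S.  The endpoint is recorded as a Bool so that
  -- every field is proof-irrelevant.
  record IsPath (a : Adj) (S : VSet) (x y : Fin n) (rest : List (Fin n)) : Set where
    constructor mkIsPath′
    field
      endsAt : T (eqB (lastOf x rest) y)
      isDistinct : T (distinct (x ∷ rest))
      isChain : T (chain a (x ∷ rest))
      inside : T (allB S (x ∷ rest))
  open IsPath public

  Paths : Adj → VSet → Fin n → Fin n → Set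
  Paths a S x y = Σ (List (Fin n)) (IsPath a S x y)

  lastOf≡ : ∀ {a S x y rest} → IsPath a S x y rest → lastOf x rest ≡ y
  lastOf≡ p = eqB⇒≡ (endsAt p)

  mkIsPath : ∀ {a S x y rest} → lastOf x rest ≡ y → T (distinct (x ∷ rest)) → T (chain a (x ∷ rest)) →
             T (allB S (x ∷ rest)) → IsPath a S x y rest
  mkIsPath e = mkIsPath′ (≡⇒eqB e)

  IsPath-irrelevant : ∀ {a S x y rest} (p q : IsPath a S x y rest) → p ≡ q
  IsPath-irrelevant (mkIsPath′ e d c s) (mkIsPath′ e′ d′ c′ s′)
    rewrite T-irrelevant e e′ | T-irrelevant d d′ | T-irrelevant c c′ | T-irrelevant s s′ = refl

  Paths-≡ : ∀ {a S x y r r′} (e : r ≡ r′) (p : IsPath a S x y r) (p′ : IsPath a S x y r′) →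
            _≡_ {A = Paths a S x y} (r , p) (r′ , p′)
  Paths-≡ refl p p′ = cong (_ ,_) (IsPath-irrelevant p p′)

  Paths-↔ : ∀ {a S x y a′ S′ x′ y′} → (∀ r → IsPath a S x y r → IsPath a′ S′ x′ y′ r) →
            (∀ r → IsPath a′ S′ x′ y′ r → IsPath a S x y r) → Paths a S x y ↔ Paths a′ S′ x′ y′
  Paths-↔ f g = mk↔ₛ′ (λ (r , p) → r , f r p) (λ (r , q) → r , g r q)
                      (λ (r , q) → Paths-≡ refl _ _) (λ (r , p) → Paths-≡ refl _ _)

  allB-cong : ∀ {S S′ : VSet} → (∀ z → S z ≡ S′ z) → ∀ xs → allB S xs ≡ allB S′ xs
  allB-cong e [] = refl
  allB-cong e (x ∷ xs) = cong₂ _∧_ (e x) (allB-cong e xs)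

  chain-cong : ∀ {S : VSet} {a a′ : Adj} → (∀ u v → T (S u) → T (S v) → a u v ≡ a′ u v) →
               ∀ xs → T (allB S xs) → chain a xs ≡ chain a′ xs
  chain-cong e [] p = refl
  chain-cong e (x ∷ []) p = refl
  chain-cong {S} e (x ∷ y ∷ xs) p =
    cong₂ _∧_ (e x y (∧-elimˡ p) (∧-elimˡ (∧-elimʳ {S x} p))) (chain-cong e (y ∷ xs) (∧-elimʳ {S x} p))

  Paths-cong : ∀ {a a′ : Adj} {S S′ : VSet} {x y} → (∀ z → S z ≡ S′ z) →
               (∀ u v → T (S u) → T (S v) → a u v ≡ a′ u v) → Paths a S x y ↔ Paths a′ S′ x y
  Paths-cong {x = x} eS ea = Paths-↔
    (λ r p → mkIsPath (lastOf≡ p) (isDistinct p) (subst T (chain-cong ea (x ∷ r) (inside p)) (isChain p))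
                      (subst T (allB-cong eS (x ∷ r)) (inside p)))
    (λ r p → let s = subst T (sym (allB-cong eS (x ∷ r))) (inside p) in
             mkIsPath (lastOf≡ p) (isDistinct p) (subst T (sym (chain-cong ea (x ∷ r) s)) (isChain p)) s)

  Paths-self : ∀ {a S x} → T (S x) → Paths a S x x ↔ Fin 1
  Paths-self {a} {S} {x} sx = mk↔ₛ′ (λ _ → zero) (λ _ → trivial) (λ { zero → refl }) (λ (r , p) → unique r p)
    where
      trivial : Paths a S x x
      trivial = [] , mkIsPath refl (distinct-cons x [] (λ ()) tt) tt (∧-intro sx tt)
      unique : ∀ r (p : IsPath a S x x r) → trivial ≡ (r , p)
      unique [] p = Paths-≡ refl _ _
      unique (z ∷ r) p = ⊥-elim (distinct-head x (z ∷ r) (isDistinct p)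
                                   (subst (λ q → T (mem q (z ∷ r))) (lastOf≡ p) (last-mem z r)))

  allB-insert : ∀ {S ℓ} xs → T (allB S xs) → T (allB (insert ℓ S) xs)
  allB-insert {ℓ = ℓ} xs = allB-mono xs (λ z s → ∨-introʳ {eqB z ℓ} s)

  allB-delete : ∀ {S ℓ} xs → T (allB (insert ℓ S) xs) → ¬ T (mem ℓ xs) → T (allB S xs)
  allB-delete {S} {ℓ} xs p ℓ∉xs = allB-intro xs λ z m → case z m (∨-elim {eqB z ℓ} (allB-mem xs p m))
    where
      case : ∀ z → T (mem z xs) → T (eqB z ℓ) ⊎ T (S z) → T (S z)
      case z m (inj₁ e) = ⊥-elim (ℓ∉xs (subst (λ q → T (mem q xs)) (eqB⇒≡ e) m))
      case z m (inj₂ s) = s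

  insert-elim : ∀ {z ℓ S} → ¬ z ≡ ℓ → T (insert ℓ S z) → T (S z)
  insert-elim {z} {ℓ} z≢ℓ p with ∨-elim {eqB z ℓ} p
  ... | inj₁ e = ⊥-elim (z≢ℓ (eqB⇒≡ e))
  ... | inj₂ s = s

  Paths-fromOutside : ∀ (a : Adj) S {ℓ y} → ¬ T (S ℓ) → T (S y) →
                      Paths a (insert ℓ S) ℓ y ↔ (Σ[ z ∈ Fin n ] ((T (S z) × T (a ℓ z)) × Paths a S z y))
  Paths-fromOutside a S {ℓ} {y} ℓ∉S y∈S = mk↔ₛ′ to from (λ _ → refl′) (λ (r , p) → fromTo r p)
    where
      B : Set
      B = Σ[ z ∈ Fin n ] ((T (S z) × T (a ℓ z)) × Paths a S z y)
      nonTrivial : IsPath a (insert ℓ S) ℓ y [] → ⊥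
      nonTrivial p = ℓ∉S (subst (λ q → T (S q)) (sym (lastOf≡ p)) y∈S)
      to : Paths a (insert ℓ S) ℓ y → B
      to ([] , p) = ⊥-elim (nonTrivial p)
      to (z ∷ r , p) = z , (allB-mem (z ∷ r) inS (mem-here z r) , chain-head ℓ z r (isChain p)) ,
                       r , mkIsPath (lastOf≡ p) (distinct-tail ℓ (z ∷ r) (isDistinct p)) (chain-tail ℓ (z ∷ r) (isChain p)) inS
        where
          inS : T (allB S (z ∷ r))
          inS = allB-delete (z ∷ r) (∧-elimʳ {insert ℓ S ℓ} (inside p)) (distinct-head ℓ (z ∷ r) (isDistinct p))
      from : B → Paths a (insert ℓ S) ℓ y
      from (z , (_ , aℓz) , r , q) = z ∷ r , mkIsPath (lastOf≡ q)
        (distinct-cons ℓ (z ∷ r) (λ m → ℓ∉S (allB-mem (z ∷ r) (inside q) m)) (isDistinct q))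
        (∧-intro aℓz (isChain q))
        (∧-intro (∨-introˡ (eqB-refl ℓ)) (allB-insert (z ∷ r) (inside q)))
      refl′ : ∀ {b} → to (from b) ≡ b
      refl′ {z , (s , e) , r , q} =
        cong₂ (λ u v → z , u , v) (cong₂ _,_ (T-irrelevant _ _) (T-irrelevant _ _)) (Paths-≡ refl _ _)
      fromTo : ∀ r (p : IsPath a (insert ℓ S) ℓ y r) → from (to (r , p)) ≡ (r , p)
      fromTo [] p = ⊥-elim (nonTrivial p)
      fromTo (z ∷ r) p = Paths-≡ refl _ _

  ×-irrelevant : ∀ {a b : Bool} → (p q : T a × T b) → p ≡ q
  ×-irrelevant (p₁ , p₂) (q₁ , q₂) = cong₂ _,_ (T-irrelevant p₁ q₁) (T-irrelevant p₂ q₂)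

  module Pendant (a : Adj) (a-sym : Symmetric a) (S : VSet) (ℓ w : Fin n) (ℓ∉S : ¬ T (S ℓ)) (w∈S : T (S w))
                 (onlyNeighbour : ∀ z → T (S z) → T (a ℓ z) → z ≡ w) where

    -- A path that enters ℓ from S must leave it again into S, through w both times.
    avoidsℓ : ∀ u L → T (S u) → T (distinct (u ∷ L)) → T (chain a (u ∷ L)) → T (allB (insert ℓ S) (u ∷ L)) →
              T (S (lastOf u L)) → T (allB S (u ∷ L))
    avoidsℓ u [] u∈S d c i l∈S = ∧-intro u∈S tt
    avoidsℓ u (v ∷ L) u∈S d c i l∈S with T? (S v)
    ... | yes v∈S = ∧-intro u∈S (avoidsℓ v L v∈S (distinct-tail u (v ∷ L) d) (chain-tail {a} u (v ∷ L) c) (∧-elimʳ {insert ℓ S u} i) l∈S)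
    ... | no v∉S = ⊥-elim (leaves L d c i l∈S)
      where
        v≡ℓ : v ≡ ℓ
        v≡ℓ with ∨-elim {eqB v ℓ} (∧-elimˡ (∧-elimʳ {insert ℓ S u} i))
        ... | inj₁ e = eqB⇒≡ e
        ... | inj₂ s = ⊥-elim (v∉S s)
        leaves : ∀ L → T (distinct (u ∷ v ∷ L)) → T (chain a (u ∷ v ∷ L)) → T (allB (insert ℓ S) (u ∷ v ∷ L)) →
                 T (S (lastOf v L)) → ⊥
        leaves [] _ _ _ l∈S = v∉S l∈S
        leaves (t ∷ L) d c i _ = distinct-head u (v ∷ t ∷ L) d (mem-there v (t ∷ L) (mem-≡ L (trans u≡w (sym t≡w))))
          where
            u≡w : u ≡ w
            u≡w = onlyNeighbour u u∈S (subst T (a-sym u ℓ) (subst (λ q → T (a u q)) v≡ℓ (chain-head {a} u v (t ∷ L) c)))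
            t≢ℓ : ¬ t ≡ ℓ
            t≢ℓ e = distinct-head v (t ∷ L) (distinct-tail u (v ∷ t ∷ L) d) (mem-≡ L (trans v≡ℓ (sym e)))
            t≡w : t ≡ w
            t≡w = onlyNeighbour t (insert-elim {S = S} t≢ℓ (∧-elimˡ (∧-elimʳ {insert ℓ S v} (∧-elimʳ {insert ℓ S u} i))))
                                  (subst (λ q → T (a q t)) v≡ℓ (chain-head {a} v t L (chain-tail {a} u (v ∷ t ∷ L) c)))

    Paths-avoidℓ : ∀ {x y} → T (S x) → T (S y) → Paths a (insert ℓ S) x y ↔ Paths a S x y
    Paths-avoidℓ {x} {y} x∈S y∈S = Paths-↔
      (λ r p → mkIsPath (lastOf≡ p) (isDistinct p) (isChain p)
                 (avoidsℓ x r x∈S (isDistinct p) (isChain p) (inside p) (subst (λ q → T (S q)) (sym (lastOf≡ p)) y∈S)))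
      (λ r p → mkIsPath (lastOf≡ p) (isDistinct p) (isChain p) (allB-insert (x ∷ r) (inside p)))

    Paths-fromℓ : ∀ {y} → T (S y) → T (a ℓ w) → Paths a (insert ℓ S) ℓ y ↔ Paths a S w y
    Paths-fromℓ {y} y∈S aℓw = ↔-trans (Paths-fromOutside a S ℓ∉S y∈S)
      (Σ-unique↔ _≟_ (λ z → Paths a S z y) w (w∈S , aℓw) (λ z (z∈S , aℓz) → onlyNeighbour z z∈S aℓz) (λ _ → ×-irrelevant))

  -- reverse (x ∷ r) = lastOf x r ∷ reversedTail x r
  reversedTail : Fin n → List (Fin n) → List (Fin n)
  reversedTail x [] = []
  reversedTail x (z ∷ zs) = reversedTail z zs ++ [ x ]

  reversedTail-snoc : ∀ y L (x : Fin n) → reversedTail y (L ++ [ x ]) ≡ lastOf y L ∷ reversedTail y L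
  reversedTail-snoc y [] x = refl
  reversedTail-snoc y (z ∷ L) x = cong (_++ [ y ]) (reversedTail-snoc z L x)

  lastOf-reversed : ∀ x r → lastOf (lastOf x r) (reversedTail x r) ≡ x
  lastOf-reversed x [] = refl
  lastOf-reversed x (z ∷ zs) = lastOf-snoc (lastOf z zs) (reversedTail z zs) x

  reversedTail-involutive : ∀ x r → reversedTail (lastOf x r) (reversedTail x r) ≡ r
  reversedTail-involutive x [] = refl
  reversedTail-involutive x (z ∷ zs) =
    trans (reversedTail-snoc (lastOf z zs) (reversedTail z zs) x)
          (cong₂ _∷_ (lastOf-reversed z zs) (reversedTail-involutive z zs))

  mem-reversed : ∀ u x r → mem u (lastOf x r ∷ reversedTail x r) ≡ mem u (x ∷ r)
  mem-reversed u x [] = refl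
  mem-reversed u x (z ∷ zs) = begin
      mem u ((lastOf z zs ∷ reversedTail z zs) ++ [ x ])
    ≡⟨ mem-++ u (lastOf z zs ∷ reversedTail z zs) [ x ] ⟩
      mem u (lastOf z zs ∷ reversedTail z zs) ∨ (eqB u x ∨ false)
    ≡⟨ cong₂ _∨_ (mem-reversed u z zs) (∨-identityʳ (eqB u x)) ⟩
      mem u (z ∷ zs) ∨ eqB u x
    ≡⟨ ∨-comm (mem u (z ∷ zs)) (eqB u x) ⟩
      eqB u x ∨ mem u (z ∷ zs) ∎
    where open ≡-Reasoning

  distinct-snoc : ∀ L x → T (distinct L) → ¬ T (mem x L) → T (distinct (L ++ [ x ]))
  distinct-snoc [] x d x∉L = distinct-cons x [] (λ ()) tt
  distinct-snoc (y ∷ L) x d x∉L =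
    distinct-cons y (L ++ [ x ]) y∉ (distinct-snoc L x (distinct-tail y L d) (λ m → x∉L (mem-there y L m)))
    where
      y∉ : ¬ T (mem y (L ++ [ x ]))
      y∉ m with ∨-elim {mem y L} (subst T (mem-++ y L [ x ]) m)
      ... | inj₁ m′ = distinct-head y L d m′
      ... | inj₂ m′ = x∉L (mem-≡ L (sym (mem-singleton m′)))

  distinct-reversed : ∀ x r → T (distinct (x ∷ r)) → T (distinct (lastOf x r ∷ reversedTail x r))
  distinct-reversed x [] d = d
  distinct-reversed x (z ∷ zs) d =
    distinct-snoc (lastOf z zs ∷ reversedTail z zs) x (distinct-reversed z zs (distinct-tail x (z ∷ zs) d))
                  (λ m → distinct-head x (z ∷ zs) d (subst T (mem-reversed x z zs) m))

  chain-reversed : ∀ {a : Adj} → Symmetric a → ∀ x r → T (chain a (x ∷ r)) →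
                   T (chain a (lastOf x r ∷ reversedTail x r))
  chain-reversed a-sym x [] c = tt
  chain-reversed {a} a-sym x (z ∷ zs) c =
    chain-snoc a (lastOf z zs) (reversedTail z zs) x (chain-reversed a-sym z zs (chain-tail {a} x (z ∷ zs) c))
      (subst (λ q → T (a q x)) (sym (lastOf-reversed z zs)) (subst T (a-sym x z) (chain-head {a} x z zs c)))

  IsPath-reverse : ∀ {a} → Symmetric a → ∀ {S x y} r → IsPath a S x y r → IsPath a S y x (reversedTail x r)
  IsPath-reverse {a} a-sym {S} {x} r p with lastOf≡ p
  ... | refl = mkIsPath (lastOf-reversed x r) (distinct-reversed x r (isDistinct p)) (chain-reversed a-sym x r (isChain p))
                        (allB-intro (lastOf x r ∷ reversedTail x r)
                                    (λ z m → allB-mem (x ∷ r) (inside p) (subst T (mem-reversed z x r) m)))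

  Paths-reverse : ∀ {a} → Symmetric a → ∀ {S} x y → Paths a S x y ↔ Paths a S y x
  Paths-reverse a-sym x y = mk↔ₛ′
    (λ (r , p) → reversedTail x r , IsPath-reverse a-sym r p)
    (λ (r , p) → reversedTail y r , IsPath-reverse a-sym r p)
    (λ (r , p) → Paths-≡ (subst (λ q → reversedTail q (reversedTail y r) ≡ r) (lastOf≡ p) (reversedTail-involutive y r)) _ _)
    (λ (r , p) → Paths-≡ (subst (λ q → reversedTail q (reversedTail x r) ≡ r) (lastOf≡ p) (reversedTail-involutive x r)) _ _)

  -- Path graphs and cycles

  edgeIn-∷-elim : ∀ x y L {u v : Fin n} → T (edgeIn (x ∷ y ∷ L) u v) →
                  (x ≡ u × y ≡ v) ⊎ (x ≡ v × y ≡ u) ⊎ T (edgeIn (y ∷ L) u v)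
  edgeIn-∷-elim x y L {u} {v} p with ∨-elim {eqB x u ∧ eqB y v} p
  ... | inj₁ q = inj₁ (eqB⇒≡ (∧-elimˡ q) , eqB⇒≡ (∧-elimʳ {eqB x u} q))
  ... | inj₂ q with ∨-elim {eqB x v ∧ eqB y u} q
  ...   | inj₁ r = inj₂ (inj₁ (eqB⇒≡ (∧-elimˡ r) , eqB⇒≡ (∧-elimʳ {eqB x v} r)))
  ...   | inj₂ r = inj₂ (inj₂ r)

  edgeIn-mem : ∀ L {u v : Fin n} → T (edgeIn L u v) → T (mem u L)
  edgeIn-mem (x ∷ y ∷ L) p =
    [ (λ (x≡u , _) → mem-≡ (y ∷ L) (sym x≡u))
    , [ (λ (_ , y≡u) → mem-there x (y ∷ L) (mem-≡ L (sym y≡u)))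
      , (λ r → mem-there x (y ∷ L) (edgeIn-mem (y ∷ L) r)) ]′ ]′ (edgeIn-∷-elim x y L p)

  edgeIn-sym : ∀ L → Symmetric (edgeIn L)
  edgeIn-sym [] u v = refl
  edgeIn-sym (x ∷ []) u v = refl
  edgeIn-sym (x ∷ y ∷ L) u v =
    trans (cong (λ t → (eqB x u ∧ eqB y v) ∨ ((eqB x v ∧ eqB y u) ∨ t)) (edgeIn-sym (y ∷ L) u v))
          (swap (eqB x u ∧ eqB y v) (eqB x v ∧ eqB y u) (edgeIn (y ∷ L) v u))
    where
      swap : ∀ a b c → a ∨ (b ∨ c) ≡ b ∨ (a ∨ c)
      swap true b c = sym (∨-zeroʳ b)
      swap false b c = refl

  edgeIn-head : ∀ (x y : Fin n) L → T (edgeIn (x ∷ y ∷ L) x y)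
  edgeIn-head x y L = ∨-introˡ (∧-intro (eqB-refl x) (eqB-refl y))

  edgeIn-drop : ∀ (q w : Fin n) s u v → ¬ q ≡ u → ¬ q ≡ v → edgeIn (q ∷ w ∷ s) u v ≡ edgeIn (w ∷ s) u v
  edgeIn-drop q w s u v q≢u q≢v rewrite ≢⇒eqB≡false q≢u | ≢⇒eqB≡false q≢v = refl

  InducesPath : Adj → List (Fin n) → Set
  InducesPath a s = ∀ u v → T (mem u s) → T (mem v s) → a u v ≡ edgeIn s u v

  -- Peel off the first vertex of s: it is a pendant vertex attached to the second one.
  Paths-inPathGraph : ∀ {a : Adj} → Symmetric a → ∀ s → T (distinct s) → InducesPath a s →
                      ∀ x y → T (mem x s) → T (mem y s) → Paths a (λ z → mem z s) x y ↔ Fin 1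
  Paths-inPathGraph a-sym (q ∷ []) d ind x y x∈ y∈ with mem-cases [] x∈ | mem-cases [] y∈
  ... | inj₁ refl | inj₁ refl = Paths-self (mem-here q [])
  Paths-inPathGraph {a} a-sym (q ∷ w ∷ s) d ind = cases (Paths-inPathGraph a-sym (w ∷ s) (distinct-tail q (w ∷ s) d) ind′)
    where
      S′ : VSet
      S′ z = mem z (w ∷ s)
      q∉S′ : ¬ T (S′ q)
      q∉S′ = distinct-head q (w ∷ s) d
      q≢ : ∀ z → T (S′ z) → ¬ q ≡ z
      q≢ z z∈ refl = q∉S′ z∈
      ind′ : InducesPath a (w ∷ s)
      ind′ u v u∈ v∈ = trans (ind u v (mem-there q (w ∷ s) u∈) (mem-there q (w ∷ s) v∈))
                             (edgeIn-drop q w s u v (q≢ u u∈) (q≢ v v∈))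
      aqw : T (a q w)
      aqw = subst T (sym (ind q w (mem-here q (w ∷ s)) (mem-there q (w ∷ s) (mem-here w s)))) (edgeIn-head q w s)
      onlyNeighbour : ∀ z → T (S′ z) → T (a q z) → z ≡ w
      onlyNeighbour z z∈ aqz with ∨-elim {eqB q q ∧ eqB w z} (subst T (ind q z (mem-here q (w ∷ s)) (mem-there q (w ∷ s) z∈)) aqz)
      ... | inj₁ r = sym (eqB⇒≡ (∧-elimʳ {eqB q q} r))
      ... | inj₂ r with ∨-elim {eqB q z ∧ eqB w q} r
      ...   | inj₁ r′ = ⊥-elim (q≢ z z∈ (eqB⇒≡ (∧-elimˡ r′)))
      ...   | inj₂ r′ = ⊥-elim (q∉S′ (edgeIn-mem (w ∷ s) r′))
      open Pendant a a-sym S′ q w q∉S′ (mem-here w s) onlyNeighbour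
      cases : (∀ x y → T (S′ x) → T (S′ y) → Paths a S′ x y ↔ Fin 1) →
              ∀ x y → T (mem x (q ∷ w ∷ s)) → T (mem y (q ∷ w ∷ s)) → Paths a (insert q S′) x y ↔ Fin 1
      cases IH x y x∈ y∈ with x ≟ q | y ≟ q
      ... | yes refl | yes refl = Paths-self (mem-here x (w ∷ s))
      ... | yes refl | no _ = ↔-trans (Paths-fromℓ y∈ aqw) (IH w y (mem-here w s) y∈)
      ... | no _ | yes refl = ↔-trans (Paths-reverse a-sym x q) (↔-trans (Paths-fromℓ x∈ aqw) (IH w x (mem-here w s) x∈))
      ... | no _ | no _ = ↔-trans (Paths-avoidℓ x∈ y∈) (IH x y x∈ y∈)

  ¬mem-++ : ∀ u L M → ¬ T (mem u (L ++ M)) → ¬ T (mem u L) × ¬ T (mem u M)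
  ¬mem-++ u L M f = (λ m → f (subst T (sym (mem-++ u L M)) (∨-introˡ m)))
                  , (λ m → f (subst T (sym (mem-++ u L M)) (∨-introʳ {mem u L} m)))

  distinct-insert : ∀ M L y → T (distinct (M ++ L)) → ¬ T (mem y (M ++ L)) → T (distinct (M ++ y ∷ L))
  distinct-insert [] L y d y∉ = distinct-cons y L y∉ d
  distinct-insert (m ∷ M) L y d y∉ =
    distinct-cons m (M ++ y ∷ L) m∉ (distinct-insert M L y (distinct-tail m (M ++ L) d) (λ q → y∉ (mem-there m (M ++ L) q)))
    where
      m∉ : ¬ T (mem m (M ++ y ∷ L))
      m∉ q with ∨-elim {mem m M} (subst T (mem-++ m M (y ∷ L)) q) | ¬mem-++ m M L (distinct-head m (M ++ L) d)
      ... | inj₁ r | m∉M , _ = m∉M r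
      ... | inj₂ r | _ , m∉L with mem-cases L r
      ...   | inj₁ refl = y∉ (mem-here m (M ++ L))
      ...   | inj₂ r′ = m∉L r′

  distinct-++-comm : ∀ L M → T (distinct (L ++ M)) → T (distinct (M ++ L))
  distinct-++-comm [] M d = subst (T ∘ distinct) (sym (++-identityʳ M)) d
  distinct-++-comm (y ∷ L) M d = distinct-insert M L y (distinct-++-comm L M (distinct-tail y (L ++ M) d))
                                   (λ q → distinct-head y (L ++ M) d (subst T (mem-++-comm y M L) q))

  distinct-++⁻ˡ : ∀ L M → T (distinct (L ++ M)) → T (distinct L)
  distinct-++⁻ˡ [] M d = tt
  distinct-++⁻ˡ (y ∷ L) M d =
    distinct-cons y L (proj₁ (¬mem-++ y L M (distinct-head y (L ++ M) d))) (distinct-++⁻ˡ L M (distinct-tail y (L ++ M) d))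

  edgeIn-++ : ∀ L (y : Fin n) M u v → edgeIn (L ++ y ∷ M) u v ≡ edgeIn (L ++ [ y ]) u v ∨ edgeIn (y ∷ M) u v
  edgeIn-++ [] y M u v = refl
  edgeIn-++ (z ∷ []) y M u v = reassoc (eqB z u ∧ eqB y v) (eqB z v ∧ eqB y u) (edgeIn (y ∷ M) u v)
    where
      reassoc : ∀ a b r → a ∨ (b ∨ r) ≡ (a ∨ (b ∨ false)) ∨ r
      reassoc a b r = trans (sym (∨-assoc a b r)) (cong (λ t → (a ∨ t) ∨ r) (sym (∨-identityʳ b)))
  edgeIn-++ (z ∷ w ∷ L) y M u v =
    trans (cong (λ t → (eqB z u ∧ eqB w v) ∨ ((eqB z v ∧ eqB w u) ∨ t)) (edgeIn-++ (w ∷ L) y M u v))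
          (reassoc (eqB z u ∧ eqB w v) (eqB z v ∧ eqB w u) (edgeIn (w ∷ L ++ [ y ]) u v) (edgeIn (y ∷ M) u v))
    where
      reassoc : ∀ a b x r → a ∨ (b ∨ (x ∨ r)) ≡ (a ∨ (b ∨ x)) ∨ r
      reassoc a b x r = trans (cong (a ∨_) (sym (∨-assoc b x r))) (sym (∨-assoc a (b ∨ x) r))

  cycEdge-rotate : ∀ A (x : Fin n) B u v → cycEdge (A ++ x ∷ B) u v ≡ cycEdge (x ∷ B ++ A) u v
  cycEdge-rotate [] x B u v = cong (λ t → cycEdge (x ∷ t) u v) (sym (++-identityʳ B))
  cycEdge-rotate (a₀ ∷ A) x B u v = begin
      edgeIn (a₀ ∷ (A ++ x ∷ B) ++ [ a₀ ]) u v
    ≡⟨ cong (λ t → edgeIn (a₀ ∷ t) u v) (++-assoc A (x ∷ B) [ a₀ ]) ⟩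
      edgeIn ((a₀ ∷ A) ++ x ∷ (B ++ [ a₀ ])) u v
    ≡⟨ edgeIn-++ (a₀ ∷ A) x (B ++ [ a₀ ]) u v ⟩
      edgeIn (a₀ ∷ A ++ [ x ]) u v ∨ edgeIn (x ∷ B ++ [ a₀ ]) u v
    ≡⟨ ∨-comm (edgeIn (a₀ ∷ A ++ [ x ]) u v) _ ⟩
      edgeIn ((x ∷ B) ++ [ a₀ ]) u v ∨ edgeIn (a₀ ∷ A ++ [ x ]) u v
    ≡⟨ sym (edgeIn-++ (x ∷ B) a₀ (A ++ [ x ]) u v) ⟩
      edgeIn ((x ∷ B) ++ a₀ ∷ (A ++ [ x ])) u v
    ≡⟨ cong (λ t → edgeIn (x ∷ t) u v) (sym (++-assoc B (a₀ ∷ A) [ x ])) ⟩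
      edgeIn (x ∷ (B ++ a₀ ∷ A) ++ [ x ]) u v ∎
    where open ≡-Reasoning

  record Rotation (cs : List (Fin n)) (x : Fin n) : Set where
    field
      rest : List (Fin n)
      mem-rot : ∀ u → mem u cs ≡ mem u (x ∷ rest)
      cycEdge-rot : ∀ u v → cycEdge cs u v ≡ cycEdge (x ∷ rest) u v
      distinct-rot : T (distinct cs) → T (distinct (x ∷ rest))
      length-rot : length cs ≡ suc (length rest)

  rotation : ∀ cs x → T (mem x cs) → Rotation cs x
  rotation cs x x∈ with split x cs x∈
  ... | A , B , refl = record
    { rest = B ++ A
    ; mem-rot = λ u → mem-++-comm u A (x ∷ B)
    ; cycEdge-rot = cycEdge-rotate A x B
    ; distinct-rot = distinct-++-comm A (x ∷ B)
    ; length-rot = length-++-comm A (x ∷ B) }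

  chain-edgeIn : ∀ L → T (chain (edgeIn L) L)
  chain-edgeIn [] = tt
  chain-edgeIn (x ∷ []) = tt
  chain-edgeIn (x ∷ y ∷ L) = ∧-intro (edgeIn-head x y L)
    (chain-mono (y ∷ L) (λ u v r → ∨-introʳ {eqB x u ∧ eqB y v} (∨-introʳ {eqB x v ∧ eqB y u} r)) (chain-edgeIn (y ∷ L)))

  chain⇒edgeIn⊆ : ∀ {a : Adj} → Symmetric a → ∀ L {u v} → T (chain a L) → T (edgeIn L u v) → T (a u v)
  chain⇒edgeIn⊆ {a} a-sym (x ∷ y ∷ L) c e =
    [ (λ (x≡u , y≡v) → subst₂ (λ s t → T (a s t)) x≡u y≡v axy)
    , [ (λ (x≡v , y≡u) → subst₂ (λ s t → T (a s t)) y≡u x≡v (subst T (a-sym x y) axy))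
      , chain⇒edgeIn⊆ a-sym (y ∷ L) (∧-elimʳ {a x y} c) ]′ ]′ (edgeIn-∷-elim x y L e)
    where
      axy : T (a x y)
      axy = ∧-elimˡ c

  edgeIn-++⁺ˡ : ∀ L M {u v : Fin n} → T (edgeIn L u v) → T (edgeIn (L ++ M) u v)
  edgeIn-++⁺ˡ (x ∷ y ∷ L) M {u} {v} e =
    [ (λ (x≡u , y≡v) → ∨-introˡ (∧-intro (≡⇒eqB x≡u) (≡⇒eqB y≡v)))
    , [ (λ (x≡v , y≡u) → ∨-introʳ {eqB x u ∧ eqB y v} (∨-introˡ (∧-intro (≡⇒eqB x≡v) (≡⇒eqB y≡u))))
      , (λ r → ∨-introʳ {eqB x u ∧ eqB y v} (∨-introʳ {eqB x v ∧ eqB y u} (edgeIn-++⁺ˡ (y ∷ L) M r))) ]′ ]′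
    (edgeIn-∷-elim x y L e)

  edgeIn-snoc-last : ∀ (y : Fin n) L z → T (edgeIn (y ∷ L ++ [ z ]) (lastOf y L) z)
  edgeIn-snoc-last y [] z = edgeIn-head y z []
  edgeIn-snoc-last y (w ∷ L) z =
    ∨-introʳ {eqB y (lastOf w L) ∧ eqB w z} (∨-introʳ {eqB y z ∧ eqB w (lastOf w L)} (edgeIn-snoc-last w L z))

  edgeIn-snoc-drop : ∀ L (x u v : Fin n) → ¬ x ≡ u → ¬ x ≡ v → edgeIn (L ++ [ x ]) u v ≡ edgeIn L u v
  edgeIn-snoc-drop [] x u v x≢u x≢v = refl
  edgeIn-snoc-drop (y ∷ []) x u v x≢u x≢v rewrite ≢⇒eqB≡false x≢u | ≢⇒eqB≡false x≢v =
    noEdge (eqB y u) (eqB y v)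
    where
      noEdge : ∀ a b → (a ∧ false) ∨ ((b ∧ false) ∨ false) ≡ false
      noEdge true true = refl
      noEdge true false = refl
      noEdge false true = refl
      noEdge false false = refl
  edgeIn-snoc-drop (y ∷ w ∷ L) x u v x≢u x≢v =
    cong (λ t → (eqB y u ∧ eqB w v) ∨ ((eqB y v ∧ eqB w u) ∨ t)) (edgeIn-snoc-drop (w ∷ L) x u v x≢u x≢v)

  edgeIn-snoc-neighbour : ∀ (y : Fin n) M x z → ¬ T (mem x (y ∷ M)) → T (edgeIn (y ∷ M ++ [ x ]) x z) → z ≡ lastOf y M
  edgeIn-snoc-neighbour y [] x z x∉ e with edgeIn-∷-elim y x [] e
  ... | inj₁ (y≡x , _) = ⊥-elim (x∉ (mem-≡ [] (sym y≡x)))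
  ... | inj₂ (inj₁ (y≡z , _)) = sym y≡z
  edgeIn-snoc-neighbour y (w ∷ M) x z x∉ e with edgeIn-∷-elim y w (M ++ [ x ]) e
  ... | inj₁ (y≡x , _) = ⊥-elim (x∉ (mem-≡ (w ∷ M) (sym y≡x)))
  ... | inj₂ (inj₁ (_ , w≡x)) = ⊥-elim (x∉ (mem-there y (w ∷ M) (mem-≡ M (sym w≡x))))
  ... | inj₂ (inj₂ r) = edgeIn-snoc-neighbour w M x z (λ m → x∉ (mem-there y (w ∷ M) m)) r

  any-allFin⁺ : ∀ (p : Fin n → Bool) z → T (p z) → T (any p (allFin n))
  any-allFin⁺ p z pz = any⁺ p (lose (∈-allFin z) pz)

  any-allFin⁻ : ∀ (p : Fin n → Bool) → T (any p (allFin n)) → Σ[ z ∈ Fin n ] T (p z)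
  any-allFin⁻ p t = satisfied (any⁻ p (allFin n) t)

  reachIn-step : ∀ (a : Adj) k {u w v} → T (reachIn a k u w) → T (a w v) → T (reachIn a (suc k) u v)
  reachIn-step a k {u} {w} {v} r e = ∨-introʳ {reachIn a k u v} (any-allFin⁺ (λ z → reachIn a k u z ∧ a z v) w (∧-intro r e))

  reachIn-mono : ∀ (a : Adj) d k {u v} → T (reachIn a k u v) → T (reachIn a (d + k) u v)
  reachIn-mono a zero k r = r
  reachIn-mono a (suc d) k r = ∨-introˡ (reachIn-mono a d k r)

  reachIn-pred : ∀ (a : Adj) k {u v} → T (reachIn a (suc k) u v) →
                 T (reachIn a k u v) ⊎ Σ[ w ∈ Fin n ] (T (reachIn a k u w) × T (a w v))
  reachIn-pred a k {u} {v} r with ∨-elim {reachIn a k u v} r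
  ... | inj₁ r′ = inj₁ r′
  ... | inj₂ r′ with any-allFin⁻ (λ z → reachIn a k u z ∧ a z v) r′
  ...   | w , q = inj₂ (w , ∧-elimˡ q , ∧-elimʳ {reachIn a k u w} q)

  reachIn-leaves : ∀ (a : Adj) (S : VSet) k {u v} → T (reachIn a k u v) → T (S u) → ¬ T (S v) →
                   Σ[ w ∈ Fin n ] Σ[ ℓ ∈ Fin n ] (T (S w) × ¬ T (S ℓ) × T (a w ℓ))
  reachIn-leaves a S zero r u∈ v∉ = ⊥-elim (v∉ (subst (T ∘ S) (eqB⇒≡ r) u∈))
  reachIn-leaves a S (suc k) r u∈ v∉ with reachIn-pred a k r
  ... | inj₁ r′ = reachIn-leaves a S k r′ u∈ v∉
  ... | inj₂ (w , r′ , e) with T? (S w)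
  ...   | yes w∈ = w , _ , w∈ , v∉ , e
  ...   | no w∉ = reachIn-leaves a S k r′ u∈ w∉

  length-filterᵇ-tabulate : ∀ {m} (P : Fin n → Bool) (f : Fin m → Fin n) → length (filterᵇ P (tabulate f)) ≡ count (P ∘ f)
  length-filterᵇ-tabulate {zero} P f = refl
  length-filterᵇ-tabulate {suc m} P f with P (f zero)
  ... | true = cong suc (length-filterᵇ-tabulate P (f ∘ suc))
  ... | false = length-filterᵇ-tabulate P (f ∘ suc)

  sum-map-cong : ∀ {f g : Fin n → ℕ} L → (∀ c → T (mem c L) → f c ≡ g c) → sum (map f L) ≡ sum (map g L)
  sum-map-cong [] _ = refl
  sum-map-cong (c ∷ L) f≡g = cong₂ _+_ (f≡g c (mem-here c L)) (sum-map-cong L (λ c′ m → f≡g c′ (mem-there c L m)))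

  sum-map-zero : ∀ {f : Fin n → ℕ} L → (∀ c → T (mem c L) → f c ≡ 0) → sum (map f L) ≡ 0
  sum-map-zero [] _ = refl
  sum-map-zero (c ∷ L) zeros = cong₂ _+_ (zeros c (mem-here c L)) (sum-map-zero L (λ c′ m → zeros c′ (mem-there c L m)))

  sum-map-select : ∀ L x (P : Fin n → Bool) → T (distinct L) → T (mem x L) → sum (map (λ c → χ (eqB x c ∧ P c)) L) ≡ χ (P x)
  sum-map-select (c ∷ L) x P d x∈ with x ≟ c
  ... | yes refl = trans (cong (χ (P x) +_) (sum-map-zero L (λ c′ c′∈ → cong (λ b → χ (b ∧ P c′)) (≢⇒eqB≡false (λ { refl → distinct-head x L d c′∈ })))))
                         (+-identityʳ (χ (P x)))
  ... | no _ = sum-map-select L x P (distinct-tail c L d) x∈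

  <ᶠ-irrefl : ∀ (u : Fin n) → ¬ T (u <ᶠ u)
  <ᶠ-irrefl u t = <-irrefl refl (<ᵇ⇒< (toℕ u) (toℕ u) t)

  PathsBetween : Graph n → Set
  PathsBetween G = Σ[ u ∈ Fin n ] Σ[ v ∈ Fin n ] (T (u <ᶠ v) × Paths (adj G) (λ _ → true) u v)

  PathSubgraph↔ : (G : Graph n) → PathSubgraph G ↔ (Fin n ⊎ PathsBetween G)
  PathSubgraph↔ G = mk↔ₛ′ to from toFrom fromTo
    where
      to : PathSubgraph G → Fin n ⊎ PathsBetween G
      to (x ∷ [] , _) = inj₁ x
      to (x ∷ y ∷ rest , p) = inj₂ (x , lastOf y rest , ∧-elimʳ {chain (adj G) (x ∷ y ∷ rest)} (∧-elimʳ {distinct (x ∷ y ∷ rest)} p) ,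
                                    y ∷ rest , mkIsPath refl (∧-elimˡ p) (∧-elimˡ (∧-elimʳ {distinct (x ∷ y ∷ rest)} p)) (allB-true (x ∷ y ∷ rest)))
      from : Fin n ⊎ PathsBetween G → PathSubgraph G
      from (inj₁ x) = x ∷ [] , tt
      from (inj₂ (u , v , u<v , [] , p)) = ⊥-elim (<ᶠ-irrefl u (subst (λ q → T (u <ᶠ q)) (sym (lastOf≡ p)) u<v))
      from (inj₂ (u , v , u<v , y ∷ rest , p)) =
        u ∷ y ∷ rest , ∧-intro (isDistinct p) (∧-intro (isChain p) (subst (λ q → T (u <ᶠ q)) (sym (lastOf≡ p)) u<v))
      toFrom : ∀ b → to (from b) ≡ b
      toFrom (inj₁ x) = refl
      toFrom (inj₂ (u , v , u<v , [] , p)) = ⊥-elim (<ᶠ-irrefl u (subst (λ q → T (u <ᶠ q)) (sym (lastOf≡ p)) u<v))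
      toFrom (inj₂ (u , v , u<v , y ∷ rest , p)) with lastOf≡ p
      ... | refl = cong₂ (λ a b → inj₂ (u , lastOf y rest , a , y ∷ rest , b)) (T-irrelevant _ _) (IsPath-irrelevant _ _)
      fromTo : ∀ a → from (to a) ≡ a
      fromTo (x ∷ [] , _) = refl
      fromTo (x ∷ y ∷ rest , p) = cong (x ∷ y ∷ rest ,_) (T-irrelevant _ _)

  closedPath-isCycle : ∀ (G : Graph n) x y z r → T (distinct (x ∷ y ∷ z ∷ r)) → T (chain (adj G) (x ∷ y ∷ z ∷ r)) →
                       T (adj G (lastOf z r) x) → T (isCycle G (x ∷ y ∷ z ∷ r))
  closedPath-isCycle G x y z r d c e = ∧-intro tt (∧-intro d (chain-snoc (adj G) x (y ∷ z ∷ r) x c e))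

  module Unicyclic (G : Graph n) (cs : List (Fin n)) (cs-cycle : T (isCycle G cs))
                   (unique : ∀ ds → T (isCycle G ds) → ∀ u v → cycEdge ds u v ≡ cycEdge cs u v) where

    length≥3 : T (3 ≤ᵇ length cs)
    length≥3 = ∧-elimˡ cs-cycle

    cs-distinct : T (distinct cs)
    cs-distinct = ∧-elimˡ (∧-elimʳ {3 ≤ᵇ length cs} cs-cycle)

    cycEdge⇒adj : ∀ {u v} → T (cycEdge cs u v) → T (adj G u v)
    cycEdge⇒adj = chain⇒edgeIn⊆ (adj-sym G) (closeup cs) (∧-elimʳ {distinct cs} (∧-elimʳ {3 ≤ᵇ length cs} cs-cycle))

    ¬adj-self : ∀ u → ¬ T (adj G u u)
    ¬adj-self u = subst T (adj-irrefl G u)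

    cycEdge⇒mem : ∀ {u v} → T (cycEdge cs u v) → T (mem u cs)
    cycEdge⇒mem {u} e = closeup-mem cs (edgeIn-mem (closeup cs) e)
      where
        closeup-mem : ∀ L → T (mem u (closeup L)) → T (mem u L)
        closeup-mem (x ∷ xs) m with mem-cases (xs ++ [ x ]) m
        ... | inj₁ u≡x = mem-≡ xs u≡x
        ... | inj₂ m′ with ∨-elim {mem u xs} (subst T (mem-++ u xs [ x ]) m′)
        ...   | inj₁ q = mem-there x xs q
        ...   | inj₂ q = mem-≡ xs (mem-singleton q)

    -- A chord u v closes, with the arc u a₁ … of the cycle, a second cycle v u a₁ … through
    -- the edge u v, so uniqueness of the cycle makes u v a cycle edge after all.
    chord⇒cycEdge : ∀ u A v B → T (distinct (u ∷ A ++ v ∷ B)) →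
                    (∀ s t → cycEdge (u ∷ A ++ v ∷ B) s t ≡ cycEdge cs s t) → T (adj G u v) → T (cycEdge cs u v)
    chord⇒cycEdge u [] v B d same auv = subst T (same u v) (edgeIn-head u v (B ++ [ u ]))
    chord⇒cycEdge u (a₁ ∷ A) v B d same auv =
      subst T (trans (edgeIn-sym (closeup ds) v u) (unique ds ds-cycle u v)) (edgeIn-head v u (a₁ ∷ A ++ [ v ]))
      where
        L : List (Fin n)
        L = u ∷ a₁ ∷ A
        ds : List (Fin n)
        ds = v ∷ L
        inCycle : ∀ {s t} → T (edgeIn (L ++ [ v ]) s t) → T (adj G s t)
        inCycle {s} {t} e = cycEdge⇒adj (subst T (same s t) (subst (λ M → T (edgeIn M s t)) closeup≡ (edgeIn-++⁺ˡ (L ++ [ v ]) (B ++ [ u ]) e)))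
          where
            closeup≡ : (L ++ [ v ]) ++ B ++ [ u ] ≡ closeup (u ∷ a₁ ∷ A ++ v ∷ B)
            closeup≡ = cong (λ t → u ∷ a₁ ∷ t) (trans (++-assoc A [ v ] (B ++ [ u ])) (sym (++-assoc A (v ∷ B) [ u ])))
        ds-cycle : T (isCycle G ds)
        ds-cycle = closedPath-isCycle G v u a₁ A
          (distinct-cons v L (proj₂ (¬mem-++ v B L (distinct-head v (B ++ L) (distinct-++-comm L (v ∷ B) d))))
                             (distinct-++⁻ˡ L (v ∷ B) d))
          (∧-intro (subst T (adj-sym G u v) auv) (chain-mono L (λ s t e → inCycle (edgeIn-++⁺ˡ L [ v ] e)) (chain-edgeIn L)))
          (inCycle (edgeIn-snoc-last u (a₁ ∷ A) v))

    chordless : ∀ u v → T (mem u cs) → T (mem v cs) → T (adj G u v) → T (cycEdge cs u v)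
    chordless u v u∈ v∈ auv with rotation cs u u∈
    ... | R with mem-cases (Rotation.rest R) (subst T (Rotation.mem-rot R v) v∈)
    ...   | inj₁ refl = ⊥-elim (¬adj-self u auv)
    ...   | inj₂ v∈rest with split v (Rotation.rest R) v∈rest
    ...     | A , B , e = chord⇒cycEdge u A v B (subst (T ∘ distinct ∘ (u ∷_)) e (Rotation.distinct-rot R cs-distinct))
                            (λ s t → trans (cong (λ r → cycEdge (u ∷ r) s t) (sym e)) (sym (Rotation.cycEdge-rot R s t))) auv

    adj≡cycEdge : ∀ u v → T (mem u cs) → T (mem v cs) → adj G u v ≡ cycEdge cs u v
    adj≡cycEdge u v u∈ v∈ with T? (adj G u v)
    ... | yes a = trans (T⇒≡true a) (sym (T⇒≡true (chordless u v u∈ v∈ a)))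
    ... | no ¬a = trans (¬T⇒≡false ¬a) (sym (¬T⇒≡false (¬a ∘ cycEdge⇒adj)))

    -- From x the two cycle neighbours p₁ and w lead into the path graph p₁ … w of the remaining
    -- cycle vertices, which has one path to y each.
    Paths-onRotation : ∀ x y p → (∀ u → mem u cs ≡ mem u (x ∷ p)) → (∀ u v → cycEdge cs u v ≡ cycEdge (x ∷ p) u v) →
                       T (distinct (x ∷ p)) → length cs ≡ suc (length p) → T (mem y p) →
                       Paths (adj G) (λ z → mem z cs) x y ↔ Fin 2
    Paths-onRotation x y (p₁ ∷ []) _ _ _ len _ = ⊥-elim (subst (λ k → T (3 ≤ᵇ k)) len length≥3)
    Paths-onRotation x y p@(p₁ ∷ p₂ ∷ p′) same-mem same-edge d _ y∈p =
      ↔-trans (Paths-cong same-mem (λ u v u∈ v∈ → trans (adj≡cycEdge u v u∈ v∈) (same-edge u v)))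
      (↔-trans (Paths-fromOutside a S x∉p y∈p)
      (↔-trans (Σ-two↔ _≟_ (λ z → Paths a S z y) p₁ w p₁≢w (mem-here p₁ (p₂ ∷ p′) , edgeIn-head x p₁ (p₂ ∷ p′ ++ [ x ]))
                       (w∈p , subst T (edgeIn-sym (closeup (x ∷ p)) w x) (edgeIn-snoc-last x p x))
                       neighbours (λ _ → ×-irrelevant))
      (↔-trans (Paths-inPathGraph a-sym p p-distinct induces p₁ y (mem-here p₁ (p₂ ∷ p′)) y∈p
                ⊎-↔ Paths-inPathGraph a-sym p p-distinct induces w y w∈p y∈p)
               (↔-sym +↔⊎))))
      where
        a : Adj
        a = cycEdge (x ∷ p)
        a-sym : Symmetric a
        a-sym = edgeIn-sym (closeup (x ∷ p))
        S : VSet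
        S z = mem z p
        x∉p : ¬ T (S x)
        x∉p = distinct-head x p d
        x≢ : ∀ z → T (S z) → ¬ x ≡ z
        x≢ z z∈ refl = x∉p z∈
        p-distinct : T (distinct p)
        p-distinct = distinct-tail x p d
        w : Fin n
        w = lastOf p₂ p′
        w∈p : T (S w)
        w∈p = mem-there p₁ (p₂ ∷ p′) (last-mem p₂ p′)
        p₁≢w : ¬ p₁ ≡ w
        p₁≢w e = distinct-head p₁ (p₂ ∷ p′) p-distinct (subst (λ q → T (mem q (p₂ ∷ p′))) (sym e) (last-mem p₂ p′))
        neighbours : ∀ z → T (S z) × T (a x z) → z ≡ p₁ ⊎ z ≡ w
        neighbours z (z∈ , axz) with edgeIn-∷-elim x p₁ (p₂ ∷ p′ ++ [ x ]) axz
        ... | inj₁ (_ , p₁≡z) = inj₁ (sym p₁≡z)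
        ... | inj₂ (inj₁ (x≡z , _)) = ⊥-elim (x≢ z z∈ x≡z)
        ... | inj₂ (inj₂ e) = inj₂ (edgeIn-snoc-neighbour p₁ (p₂ ∷ p′) x z x∉p e)
        induces : InducesPath a p
        induces u v u∈ v∈ = trans (edgeIn-drop x p₁ (p₂ ∷ p′ ++ [ x ]) u v (x≢ u u∈) (x≢ v v∈))
                                  (edgeIn-snoc-drop p x u v (x≢ u u∈) (x≢ v v∈))

    Paths-onCycle : ∀ x y → T (mem x cs) → T (mem y cs) → ¬ x ≡ y → Paths (adj G) (λ z → mem z cs) x y ↔ Fin 2
    Paths-onCycle x y x∈ y∈ x≢y with rotation cs x x∈
    ... | R with mem-cases (Rotation.rest R) (subst T (Rotation.mem-rot R y) y∈)
    ...   | inj₁ e = ⊥-elim (x≢y (sym e))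
    ...   | inj₂ y∈rest = Paths-onRotation x y (Rotation.rest R) (Rotation.mem-rot R) (Rotation.cycEdge-rot R)
                                           (Rotation.distinct-rot R cs-distinct) (Rotation.length-rot R) y∈rest

    -- Exploring a unicyclic graph from its cycle

    forest : Adj
    forest = delEdges G cs

    cycEdge⇒mem′ : ∀ {u v} → T (cycEdge cs u v) → T (mem v cs)
    cycEdge⇒mem′ {u} {v} e = cycEdge⇒mem (subst T (edgeIn-sym (closeup cs) u v) e)

    expectedPaths : (Fin n → Fin n) → Fin n → Fin n → ℕ
    expectedPaths r x y = if eqB (r x) (r y) then 1 else 2

    expectedPaths-refl : ∀ r x → expectedPaths r x x ≡ 1
    expectedPaths-refl r x = cong (λ b → if b then 1 else 2) (T⇒≡true (eqB-refl (r x)))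

    expectedPaths-sym : ∀ r x y → expectedPaths r x y ≡ expectedPaths r y x
    expectedPaths-sym r x y = cong (λ b → if b then 1 else 2) (eqB-sym (r x) (r y))

    somePath : ∀ r x y → Fin (expectedPaths r x y)
    somePath r x y with eqB (r x) (r y)
    ... | true = zero
    ... | false = zero

    -- S ⊇ cs has been explored in k steps: each x ∈ S hangs off the cycle vertex r x in the forest
    -- G − E(C), and the paths inside S are counted as in the theorem.
    record Explored (S : VSet) (r : Fin n → Fin n) (k : ℕ) : Set where
      field
        cycle⊆ : ∀ z → T (mem z cs) → T (S z)
        root∈cycle : ∀ x → T (S x) → T (mem (r x) cs)
        root-reaches : ∀ x → T (S x) → T (reachIn forest k (r x) x)
        root-forest : ∀ u v → T (S u) → T (S v) → T (forest u v) → r u ≡ r v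
        root-cycle : ∀ c → T (mem c cs) → r c ≡ c
        paths : ∀ x y → T (S x) → T (S y) → Paths (adj G) S x y ↔ Fin (expectedPaths r x y)

    cycleExplored : Explored (λ z → mem z cs) (λ z → z) 0
    cycleExplored = record
      { cycle⊆ = λ z z∈ → z∈
      ; root∈cycle = λ x x∈ → x∈
      ; root-reaches = λ x _ → eqB-refl x
      ; root-forest = λ u v u∈ v∈ f → ⊥-elim (not-elim (∧-elimʳ {adj G u v} f) (chordless u v u∈ v∈ (∧-elimˡ f)))
      ; root-cycle = λ c _ → refl
      ; paths = cyclePaths }
      where
        cyclePaths : ∀ x y → T (mem x cs) → T (mem y cs) → Paths (adj G) (λ z → mem z cs) x y ↔ Fin (expectedPaths (λ z → z) x y)
        cyclePaths x y x∈ y∈ with x ≟ y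
        ... | yes refl = Paths-self x∈
        ... | no x≢y = Paths-onCycle x y x∈ y∈ x≢y

    attach : (Fin n → Fin n) → Fin n → Fin n → Fin n → Fin n
    attach r ℓ w z = if eqB z ℓ then r w else r z


    module Attach {S r k} (E : Explored S r k) {ℓ w} (ℓ∉S : ¬ T (S ℓ)) (w∈S : T (S w)) (awℓ : T (adj G w ℓ)) where
      open Explored E

      r′ : Fin n → Fin n
      r′ = attach r ℓ w

      S′ : VSet
      S′ = insert ℓ S

      ℓ∉cs : ¬ T (mem ℓ cs)
      ℓ∉cs = ℓ∉S ∘ cycle⊆ ℓ

      aℓw : T (adj G ℓ w)
      aℓw = subst T (adj-sym G w ℓ) awℓ

      -- A second neighbour z of ℓ in S closes a path w … z inside S to a cycle through ℓ ∉ cs.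
      noSecondNeighbour : ∀ z rest → T (adj G ℓ z) → IsPath (adj G) S w z rest → ¬ z ≡ w → ⊥
      noSecondNeighbour z [] aℓz p z≢w = z≢w (sym (lastOf≡ p))
      noSecondNeighbour z (t ∷ rest) aℓz p _ =
        ℓ∉cs (cycEdge⇒mem (subst T (unique ds ds-cycle ℓ w) (edgeIn-head ℓ w (t ∷ rest ++ [ ℓ ]))))
        where
          ds : List (Fin n)
          ds = ℓ ∷ w ∷ t ∷ rest
          ds-cycle : T (isCycle G ds)
          ds-cycle = closedPath-isCycle G ℓ w t rest
            (distinct-cons ℓ (w ∷ t ∷ rest) (λ m → ℓ∉S (allB-mem {S} {ℓ} (w ∷ t ∷ rest) (inside p) m)) (isDistinct p))
            (∧-intro aℓw (isChain p))
            (subst (λ q → T (adj G q ℓ)) (sym (lastOf≡ p)) (subst T (adj-sym G ℓ z) aℓz))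

      onlyNeighbour : ∀ z → T (S z) → T (adj G ℓ z) → z ≡ w
      onlyNeighbour z z∈ aℓz with z ≟ w
      ... | yes e = e
      ... | no z≢w with Inverse.from (paths w z w∈S z∈) (somePath r w z)
      ...   | rest , p = ⊥-elim (noSecondNeighbour z rest aℓz p z≢w)

      open Pendant (adj G) (adj-sym G) S ℓ w ℓ∉S w∈S onlyNeighbour

      -- Splitting on x ≟ ℓ and y ≟ ℓ also evaluates r′ x and r′ y in the goal.
      paths′ : ∀ x y → T (S′ x) → T (S′ y) → Paths (adj G) S′ x y ↔ Fin (expectedPaths r′ x y)
      paths′ x y x∈ y∈ with x ≟ ℓ | y ≟ ℓ
      ... | yes refl | yes refl = Fin-cast (sym (expectedPaths-refl r w)) (Paths-self (∨-introˡ (eqB-refl x)))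
      ... | yes refl | no _ = ↔-trans (Paths-fromℓ y∈ aℓw) (paths w y w∈S y∈)
      ... | no _ | yes refl = Fin-cast (expectedPaths-sym r w x)
                                (↔-trans (Paths-reverse (adj-sym G) x y) (↔-trans (Paths-fromℓ x∈ aℓw) (paths w x w∈S x∈)))
      ... | no _ | no _ = ↔-trans (Paths-avoidℓ x∈ y∈) (paths x y x∈ y∈)

      forest-wℓ : T (forest w ℓ)
      forest-wℓ = ∧-intro awℓ (not-intro (ℓ∉cs ∘ cycEdge⇒mem′))

      explored′ : Explored S′ r′ (suc k)
      explored′ = record
        { cycle⊆ = λ z z∈ → ∨-introʳ {eqB z ℓ} (cycle⊆ z z∈)
        ; root∈cycle = root∈cycle′
        ; root-reaches = root-reaches′
        ; root-forest = root-forest′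
        ; root-cycle = root-cycle′
        ; paths = paths′ }
        where
          root∈cycle′ : ∀ x → T (S′ x) → T (mem (r′ x) cs)
          root∈cycle′ x x∈ with x ≟ ℓ
          ... | yes refl = root∈cycle w w∈S
          ... | no _ = root∈cycle x x∈
          root-reaches′ : ∀ x → T (S′ x) → T (reachIn forest (suc k) (r′ x) x)
          root-reaches′ x x∈ with x ≟ ℓ
          ... | yes refl = reachIn-step forest k (root-reaches w w∈S) forest-wℓ
          ... | no _ = ∨-introˡ (root-reaches x x∈)
          root-forest′ : ∀ u v → T (S′ u) → T (S′ v) → T (forest u v) → r′ u ≡ r′ v
          root-forest′ u v u∈ v∈ f with u ≟ ℓ | v ≟ ℓ
          ... | yes refl | yes refl = refl
          ... | yes refl | no _ = cong r (sym (onlyNeighbour v v∈ (∧-elimˡ f)))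
          ... | no _ | yes refl = cong r (onlyNeighbour u u∈ (subst T (adj-sym G u v) (∧-elimˡ f)))
          ... | no _ | no _ = root-forest u v u∈ v∈ f
          root-cycle′ : ∀ c → T (mem c cs) → r′ c ≡ c
          root-cycle′ c c∈ with c ≟ ℓ
          ... | yes refl = ⊥-elim (ℓ∉cs c∈)
          ... | no _ = root-cycle c c∈

    someCycleVertex : Σ[ c ∈ Fin n ] T (mem c cs)
    someCycleVertex = head cs length≥3
      where
        head : ∀ L → T (3 ≤ᵇ length L) → Σ[ c ∈ Fin n ] T (mem c L)
        head (c ∷ L) _ = c , mem-here c L

    record ExploredAll : Set where
      field
        {S} : VSet
        root : Fin n → Fin n
        steps : ℕ
        explored : Explored S root steps
        everything : ∀ z → T (S z)
        steps≤n : steps ≤ n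

    -- m is the number of vertices not yet explored; connectivity provides an edge w ℓ leaving S.
    explore : Connected G → ∀ m {S r k} → Explored S r k → count (not ∘ S) ≡ m → k + m ≤ n → ExploredAll
    explore conn zero {S} {r} {k} E unexplored k≤n = record
      { explored = E
      ; everything = λ z → ¬T-not⇒T (count≡0⇒¬T (not ∘ S) unexplored z)
      ; steps≤n = subst (_≤ n) (+-identityʳ k) k≤n }
    explore conn (suc m) {S} {r} {k} E unexplored k+m≤n with count-witness (not ∘ S) unexplored | someCycleVertex
    ... | t , t∉S | c , c∈ with reachIn-leaves (adj G) S n (conn c t) (Explored.cycle⊆ E c c∈) (not-elim t∉S)
    ...   | w , ℓ , w∈S , ℓ∉S , awℓ =
      explore conn m (Attach.explored′ E ℓ∉S w∈S awℓ)
              (suc-injective (trans (sym (count-remove ℓ (not-intro ℓ∉S) (λ q → not-elim q (∨-introˡ (eqB-refl ℓ))) unchanged))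
                                    unexplored))
              (subst (_≤ n) (+-suc k m) k+m≤n)
      where
        unchanged : ∀ z → ¬ z ≡ ℓ → not (S z) ≡ not (insert ℓ S z)
        unchanged z z≢ℓ rewrite ≢⇒eqB≡false z≢ℓ = refl

    exploreAll : Connected G → ExploredAll
    exploreAll conn = explore conn _ cycleExplored refl (count≤ _)

    module Rooted (conn : Connected G) where
      open ExploredAll (exploreAll conn)
      open Explored explored

      reachIn⇒sameRoot : ∀ j {u v} → T (reachIn forest j u v) → root v ≡ root u
      reachIn⇒sameRoot zero r = cong root (sym (eqB⇒≡ r))
      reachIn⇒sameRoot (suc j) r with reachIn-pred forest j r
      ... | inj₁ r′ = reachIn⇒sameRoot j r′
      ... | inj₂ (w , r′ , f) = trans (sym (root-forest w _ (everything w) (everything _) f)) (reachIn⇒sameRoot j r′)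

      root-reachIn : ∀ x → T (reachIn forest n (root x) x)
      root-reachIn x = subst (λ j → T (reachIn forest j (root x) x)) (m∸n+n≡m steps≤n)
                             (reachIn-mono forest (n ∸ steps) steps (root-reaches x (everything x)))

      reachIn≡rootIs : ∀ c → T (mem c cs) → ∀ x → reachIn forest n c x ≡ eqB (root x) c
      reachIn≡rootIs c c∈ x with T? (reachIn forest n c x)
      ... | yes r = trans (T⇒≡true r) (sym (T⇒≡true (≡⇒eqB (trans (reachIn⇒sameRoot n r) (root-cycle c c∈)))))
      ... | no ¬r = trans (¬T⇒≡false ¬r) (sym (¬T⇒≡false (λ e → ¬r (subst (λ s → T (reachIn forest n s x)) (eqB⇒≡ e) (root-reachIn x)))))

      compSize≡count : ∀ c → T (mem c cs) → compSize G cs c ≡ count (λ x → eqB (root x) c)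
      compSize≡count c c∈ = trans (length-filterᵇ-tabulate (reachIn forest n c) (λ x → x)) (count-cong (reachIn≡rootIs c c∈))

      root∈cycle′ : ∀ x → T (mem (root x) cs)
      root∈cycle′ x = root∈cycle x (everything x)

      Paths↔expected : ∀ x y → Paths (adj G) (λ _ → true) x y ↔ Fin (expectedPaths root x y)
      Paths↔expected x y = ↔-trans (Paths-cong (λ z → sym (T⇒≡true (everything z))) (λ _ _ _ _ → refl))
                                    (paths x y (everything x) (everything y))

      pathsBetween : ℕ
      pathsBetween = ∑[ u < n ] ∑[ v < n ] (if u <ᶠ v then expectedPaths root u v else 0)

      PathsBetween↔Fin : PathsBetween G ↔ Fin pathsBetween
      PathsBetween↔Fin =
        ↔-trans (Σ-congˡ λ {u} → Σ-congˡ λ {v} → T×↔Fin (u <ᶠ v) (λ _ → Paths↔expected u v))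
                (↔-trans (Σ-congˡ (Σ-Fin↔Fin-∑ _)) (Σ-Fin↔Fin-∑ _))

      sameRootPairs : ℕ
      sameRootPairs = ∑[ u < n ] ∑[ v < n ] χ (u <ᶠ v ∧ eqB (root u) (root v))

      sum-C2≡sameRootPairs : sum (map (λ c → compSize G cs c C 2) cs) ≡ sameRootPairs
      sum-C2≡sameRootPairs = begin
          sum (map (λ c → compSize G cs c C 2) cs)
        ≡⟨ sum-map-cong cs (λ c c∈ → trans (cong (_C 2) (compSize≡count c c∈)) (sym (∑-pairs≡C2 (λ x → eqB (root x) c)))) ⟩
          sum (map (λ c → ∑[ u < n ] ∑[ v < n ] pair c u v) cs)
        ≡⟨ sym (∑-sum-comm (λ u c → ∑[ v < n ] pair c u v) cs) ⟩
          ∑[ u < n ] sum (map (λ c → ∑[ v < n ] pair c u v) cs)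
        ≡⟨ sum-cong-≗ (λ u → sym (∑-sum-comm (λ v c → pair c u v) cs)) ⟩
          ∑[ u < n ] ∑[ v < n ] sum (map (λ c → pair c u v) cs)
        ≡⟨ sum-cong-≗ (λ u → sum-cong-≗ (λ v → commonRoot (u <ᶠ v) (root∈cycle′ u))) ⟩
          sameRootPairs ∎
        where
          open ≡-Reasoning
          pair : Fin n → Fin n → Fin n → ℕ
          pair c u v = χ (u <ᶠ v ∧ (eqB (root u) c ∧ eqB (root v) c))
          commonRoot : ∀ {x y} b → T (mem x cs) → sum (map (λ c → χ (b ∧ (eqB x c ∧ eqB y c))) cs) ≡ χ (b ∧ eqB x y)
          commonRoot false _ = sum-map-zero cs (λ _ _ → refl)
          commonRoot {x} {y} true x∈ = trans (sum-map-select cs x (eqB y) cs-distinct x∈) (cong χ (eqB-sym y x))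

      -- A pair u < v is joined by one path if it lies in a single component of G − E(C) and by two
      -- otherwise, so paths plus the same-component indicator is always 2.
      pathsBetween+sameRootPairs : pathsBetween + sameRootPairs ≡ 2 * (n C 2)
      pathsBetween+sameRootPairs = begin
          pathsBetween + sameRootPairs
        ≡⟨ sym (∑∑-distrib-+ (λ u v → if u <ᶠ v then expectedPaths root u v else 0) (λ u v → χ (u <ᶠ v ∧ eqB (root u) (root v)))) ⟩
          ∑[ u < n ] ∑[ v < n ] ((if u <ᶠ v then expectedPaths root u v else 0) + χ (u <ᶠ v ∧ eqB (root u) (root v)))
        ≡⟨ sum-cong-≗ (λ u → sum-cong-≗ (λ v → perPair (u <ᶠ v) (eqB (root u) (root v)))) ⟩
          ∑[ u < n ] ∑[ v < n ] (anyPair u v + anyPair u v)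
        ≡⟨ ∑∑-distrib-+ anyPair anyPair ⟩
          ∑[ u < n ] ∑[ v < n ] anyPair u v + ∑[ u < n ] ∑[ v < n ] anyPair u v
        ≡⟨ cong₂ _+_ allPairs allPairs ⟩
          n C 2 + n C 2
        ≡⟨ cong (n C 2 +_) (sym (+-identityʳ (n C 2))) ⟩
          2 * (n C 2) ∎
        where
          open ≡-Reasoning
          anyPair : Fin n → Fin n → ℕ
          anyPair u v = χ (u <ᶠ v ∧ (true ∧ true))
          allPairs : ∑[ u < n ] ∑[ v < n ] anyPair u v ≡ n C 2
          allPairs = trans (∑-pairs≡C2 {n} (λ _ → true)) (cong (_C 2) (count-true n))
          perPair : ∀ b s → (if b then (if s then 1 else 2) else 0) + χ (b ∧ s) ≡ χ (b ∧ (true ∧ true)) + χ (b ∧ (true ∧ true))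
          perPair true true = refl
          perPair true false = refl
          perPair false s = refl

      PathSubgraph↔Fin : PathSubgraph G ↔ Fin (n + 2 * (n C 2) ∸ sum (map (λ c → compSize G cs c C 2) cs))
      PathSubgraph↔Fin = ↔-trans (PathSubgraph↔ G) (↔-trans (↔-refl ⊎-↔ PathsBetween↔Fin) (↔-trans (↔-sym +↔⊎) (Fin-cast total ↔-refl)))
        where
          open ≡-Reasoning
          total : n + pathsBetween ≡ n + 2 * (n C 2) ∸ sum (map (λ c → compSize G cs c C 2) cs)
          total = sym (begin
              n + 2 * (n C 2) ∸ sum (map (λ c → compSize G cs c C 2) cs)
            ≡⟨ cong₂ (λ s t → n + s ∸ t) (sym pathsBetween+sameRootPairs) sum-C2≡sameRootPairs ⟩
              n + (pathsBetween + sameRootPairs) ∸ sameRootPairs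
            ≡⟨ cong (_∸ sameRootPairs) (sym (+-assoc n pathsBetween sameRootPairs)) ⟩
              n + pathsBetween + sameRootPairs ∸ sameRootPairs
            ≡⟨ m+n∸n≡m (n + pathsBetween) sameRootPairs ⟩
              n + pathsBetween ∎)

mainTheorem4 : ∀ {n} (G : Graph n) (cs : List (Fin n)) →
    Connected G →
    T (isCycle G cs) →
    (∀ ds → T (isCycle G ds) → ∀ u v → cycEdge ds u v ≡ cycEdge cs u v) →
    Fin (n + 2 * (n C 2) ∸ sum (map (λ c → compSize G cs c C 2) cs)) ↔ PathSubgraph G
mainTheorem4 G cs conn cs-cycle unique = ↔-sym (Unicyclic.Rooted.PathSubgraph↔Fin G cs cs-cycle unique conn)
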